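{- With the notation of the context, for every $n\ge1$ the following identity holds in $\mathcal{A}$: $$(\rho X)^{[n-1]}X=\sum_{\substack{i_1+\cdots+i_k=n\\ i_1,\dots,i_k>0}}\frac{c^{(i_1)}(X)\ast_\rho c^{(i_2)}(X)\ast_\rho\cdots\ast_\rho c^{(i_k)}(X)}{i_1(i_1+i_2)\cdots(i_1+\cdots+i_k)},$$ the sum running over all compositions of $n$.
   Context: $\mathbb{K}$ is a field of characteristic zero; $T(X)$ is the free associative unital $\mathbb{K}$-algebra on countably many noncommuting variables $x_1,x_2,\dots$; $\mathcal{A}$ is the algebra of sequences $(y_1,y_2,\dots)$ of elements of $T(X)$ with componentwise operations; $\rho(y_1,y_2,\dots)=(0,y_1,y_1+y_2,y_1+y_2+y_3,\dots)$; $X=(x_1,x_2,\dots)\in\mathcal{A}$. $(\rho X)^{[0]}=1$, $(\rho X)^{[n+1]}=\rho((\rho X)^{[n]}X)$ (so $(\rho X)^{[0]}X=X$). The associative double product is $a\ast_\rho b=\rho(a)b+a\rho(b)+ab$. Define $a\bullet_\rho b:=\rho(a)b-b\rho(a)-ba$, $c^{(1)}(a)=a$ and $c^{(n)}(a)=c^{(n-1)}(a)\bullet_\rho a$ (left-nested). -}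

module Defs where

open import Level using (Level; _⊔_) renaming (suc to lsuc)
open import Algebra.Bundles using (CommutativeRing)
open import Data.Nat using (ℕ; zero; suc) renaming (_+_ to _+ℕ_; _*_ to _*ℕ_)
open import Data.List using (List; []; _∷_; [_]; _++_; map; concatMap; foldr; foldl)
open import Data.List.Properties using (≡-dec)
open import Data.Nat.Properties using (_≟_)
open import Data.Product using (Σ; _,_; proj₁; proj₂) renaming (_×_ to _×ₚ_)
open import Relation.Nullary using (¬_; yes; no)

record Field (c ℓ : Level) : Set (lsuc (c ⊔ ℓ)) where
  field
    commutativeRing : CommutativeRing c ℓ
  open CommutativeRing commutativeRing public
  field
    0≉1     : ¬ (0# ≈ 1#)
    inverse : ∀ x → ¬ (x ≈ 0#) → Σ Carrier (λ y → (x * y) ≈ 1#)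

fromℕ : ∀ {c ℓ} (F : Field c ℓ) → ℕ → Field.Carrier F
fromℕ F zero    = Field.0# F
fromℕ F (suc n) = Field._+_ F (Field.1# F) (fromℕ F n)

CharZero : ∀ {c ℓ} → Field c ℓ → Set ℓ
CharZero F = ∀ n → ¬ (Field._≈_ F (fromℕ F (suc n)) (Field.0# F))

module Alg {c ℓ} (F : Field c ℓ) (χ : CharZero F) where
  open Field F using (_≈_; _+_; _*_; -_; 0#; 1#; inverse) renaming (Carrier to K)

  -- 1/n in K for n ≥ 1 (the value at 0 is an irrelevant junk value 0).
  invℕ : ℕ → K
  invℕ zero    = 0#
  invℕ (suc n) = proj₁ (inverse (fromℕ F (suc n)) (χ n))

  -- T(X): the free associative unital K-algebra on variables x₀,x₁,...
  -- (x_{m+1} of the paper is the variable indexed by m here).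
  -- An element is a finite formal K-linear combination of words;
  -- equality is equality of all coefficients.

  Word : Set
  Word = List ℕ

  T : Set c
  T = List (K ×ₚ Word)

  coeff : T → Word → K
  coeff []             w = 0#
  coeff ((a , u) ∷ p) w with ≡-dec _≟_ u w
  ... | yes _ = a + coeff p w
  ... | no  _ = coeff p w

  _≈T_ : T → T → Set ℓ
  p ≈T q = ∀ w → coeff p w ≈ coeff q w

  0T : T
  0T = []

  1T : T
  1T = [ (1# , []) ]

  var : ℕ → T
  var m = [ (1# , [ m ]) ]

  _+T_ : T → T → T
  p +T q = p ++ q

  -T_ : T → T
  -T p = map (λ { (a , u) → (- a , u) }) p

  _·T_ : K → T → T
  k ·T p = map (λ { (a , u) → (k * a , u) }) p

  _*T_ : T → T → T
  p *T q = concatMap (λ { (a , u) → map (λ { (b , v) → (a * b , u ++ v) }) q }) p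

  -- 𝒜: sequences (y₁,y₂,...) of elements of T(X), indexed here from 0,
  -- with componentwise operations.

  𝒜 : Set c
  𝒜 = ℕ → T

  _≈A_ : 𝒜 → 𝒜 → Set ℓ
  a ≈A b = ∀ m → a m ≈T b m

  0A 1A : 𝒜
  0A m = 0T
  1A m = 1T

  _+A_ _-A_ _*A_ : 𝒜 → 𝒜 → 𝒜
  (a +A b) m = a m +T b m
  (a -A b) m = a m +T (-T b m)
  (a *A b) m = a m *T b m

  _·A_ : K → 𝒜 → 𝒜
  (k ·A a) m = k ·T a m

  psum : 𝒜 → ℕ → T
  psum y zero    = y zero
  psum y (suc m) = psum y m +T y (suc m)

  ρ : 𝒜 → 𝒜
  ρ y zero    = 0T
  ρ y (suc m) = psum y m

  𝕏 : 𝒜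
  𝕏 m = var m

  ρpow : ℕ → 𝒜
  ρpow zero    = 1A
  ρpow (suc n) = ρ (ρpow n *A 𝕏)

  _∗ρ_ : 𝒜 → 𝒜 → 𝒜
  a ∗ρ b = ((ρ a *A b) +A (a *A ρ b)) +A (a *A b)

  _•ρ_ : 𝒜 → 𝒜 → 𝒜
  a •ρ b = ((ρ a *A b) -A (b *A ρ a)) -A (b *A a)

  -- c⁽¹⁾(a) = a, c⁽ⁿ⁾(a) = c⁽ⁿ⁻¹⁾(a) •ρ a   (c⁽⁰⁾ is unused junk)
  cpow : ℕ → 𝒜 → 𝒜
  cpow zero          a = a
  cpow (suc zero)    a = a
  cpow (suc (suc n)) a = cpow (suc n) a •ρ a

  -- Generated recursively: every composition of n+1 arises uniquely from a
  -- composition of n either by prepending a part 1 or by adding 1 to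
  -- the first part.

  incHead : List ℕ → List ℕ
  incHead []       = []
  incHead (i ∷ is) = suc i ∷ is

  compositions : ℕ → List (List ℕ)
  compositions zero          = [ [] ]
  compositions (suc zero)    = [ [ 1 ] ]
  compositions (suc (suc n)) =
    map (1 ∷_) (compositions (suc n)) ++ map incHead (compositions (suc n))

  denomFrom : ℕ → List ℕ → ℕ
  denomFrom acc []       = 1
  denomFrom acc (i ∷ is) = (acc +ℕ i) *ℕ denomFrom (acc +ℕ i) is

  denom : List ℕ → ℕ
  denom = denomFrom 0

  starProd : List ℕ → 𝒜
  starProd []       = 1A
  starProd (i ∷ is) = foldl (λ acc j → acc ∗ρ cpow j 𝕏) (cpow i 𝕏) is

  sumA : List 𝒜 → 𝒜
  sumA = foldr _+A_ 0A

  RHS : ℕ → 𝒜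
  RHS n = sumA (map (λ is → invℕ (denom is) ·A starProd is) (compositions n))

-- Write Yₘ for either side of the identity at n = m + 1.  Both sequences satisfy
--
--   (m + 1) · Yₘ = c⁽ᵐ⁺¹⁾(X) + Σ_{a+b=m-1} Y_a ∗ρ c⁽ᵇ⁺¹⁾(X)        (Y₀ = X),
--
-- and this recurrence determines Yₘ from Y₀, …, Y_{m-1}, so they agree.
-- For the sum over compositions, split off the last part j of i₁ + ⋯ + i_k = n:
-- the denominator acquires the factor n and the ∗ρ-product the factor c⁽ʲ⁾(X).
-- For Yₘ = (ρX)^[m] X one proves alongside, by induction on k, that
--
--   (k + 1) · (ρX)^[k+1] = Σ_{a+b=k} (ρX)^[a] ρ(c⁽ᵇ⁺¹⁾(X)),
--
-- using that ρ is a Rota–Baxter operator of weight 1, ρ(a)ρ(b) = ρ(a ∗ρ b), and the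
-- definition of c⁽ʲ⁺¹⁾ in the form ρ(c⁽ʲ⁾)X = c⁽ʲ⁺¹⁾ + Xρ(c⁽ʲ⁾) + Xc⁽ʲ⁾.

module Submission where

open import Defs
open import Level using (Level; _⊔_)
open import Algebra.Bundles using (CommutativeMonoid; Ring)
import Algebra.Construct.Pointwise as Pointwise
open import Data.Bool using (if_then_else_)
open import Data.Empty using (⊥-elim)
open import Data.List using (List; []; _∷_; _++_; map; foldr; concat; [_])
open import Data.List.Properties
  using (≡-dec; ∷-injectiveˡ; ∷-injectiveʳ; ++-assoc; ++-identityʳ; map-id; map-∘; map-++; foldl-++; concat-map-[_])
open import Data.List.Relation.Unary.All as All using (All; []; _∷_)
open import Data.List.Relation.Unary.All.Properties using (++⁺; map⁺)
open import Data.Nat using (ℕ; zero; suc; _≤_; _<_; _∸_; s≤s; z≤n) renaming (_+_ to _+ℕ_; _*_ to _*ℕ_; _≟_ to _≟ℕ_)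
open import Data.Nat.Induction using (<-rec)
open import Data.Nat.ListAction using (sum)
import Data.Nat.Properties as ℕ
open import Data.Product using (_×_; _,_; proj₁; proj₂; map₁)
open import Function using (_∘_)
open import Relation.Binary.PropositionalEquality as ≡ using (_≡_; _≢_)
open import Relation.Binary.Structures using (IsEquivalence)
open import Relation.Nullary using (Dec; does; yes; no)

module Notation {c ℓ} (F : Field c ℓ) (χ : CharZero F) where
  open Alg F χ public
    renaming (_+A_ to infixl 6 _+A_; _-A_ to infixl 6 _-A_; _*A_ to infixl 7 _*A_; _·A_ to infixr 7 _·A_; _∗ρ_ to infixl 7 _∗ρ_)

module ListSum {a ℓ} (M : CommutativeMonoid a ℓ) where
  open CommutativeMonoid M
  open import Algebra.Solver.CommutativeMonoid M using (solve; _⊕_; _⊜_)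
  open import Relation.Binary.Reasoning.Setoid setoid

  -- Chosen so that sumA (map f xs) from Defs is ∑ xs f definitionally.
  ∑ : {A : Set} → List A → (A → Carrier) → Carrier
  ∑ xs f = foldr _∙_ ε (map f xs)

  syntax ∑ xs (λ x → e) = ∑[ x ∈ xs ] e

  module _ {A : Set} where

    ∑-cong-All : ∀ {p} {P : A → Set p} {f g : A → Carrier} {xs} →
                 All P xs → (∀ {x} → P x → f x ≈ g x) → ∑ xs f ≈ ∑ xs g
    ∑-cong-All []         f≈g = refl
    ∑-cong-All (px ∷ pxs) f≈g = ∙-cong (f≈g px) (∑-cong-All pxs f≈g)

    ∑-cong : ∀ (xs : List A) {f g : A → Carrier} → (∀ x → f x ≈ g x) → ∑ xs f ≈ ∑ xs g
    ∑-cong []       f≈g = refl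
    ∑-cong (x ∷ xs) f≈g = ∙-cong (f≈g x) (∑-cong xs f≈g)

    ∑-zero : ∀ (xs : List A) {f : A → Carrier} → (∀ x → f x ≈ ε) → ∑ xs f ≈ ε
    ∑-zero []       f≈ε = refl
    ∑-zero (x ∷ xs) f≈ε = trans (∙-cong (f≈ε x) (∑-zero xs f≈ε)) (identityˡ ε)

    ∑-++ : ∀ (xs ys : List A) (f : A → Carrier) → ∑ (xs ++ ys) f ≈ ∑ xs f ∙ ∑ ys f
    ∑-++ []       ys f = sym (identityˡ _)
    ∑-++ (x ∷ xs) ys f = trans (∙-congˡ (∑-++ xs ys f)) (sym (assoc _ _ _))

    ∑-distrib-∙ : ∀ (xs : List A) (f g : A → Carrier) → ∑[ x ∈ xs ] (f x ∙ g x) ≈ ∑ xs f ∙ ∑ xs g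
    ∑-distrib-∙ []       f g = sym (identityˡ ε)
    ∑-distrib-∙ (x ∷ xs) f g = trans (∙-congˡ (∑-distrib-∙ xs f g))
      (solve 4 (λ a b c d → (a ⊕ b) ⊕ (c ⊕ d) ⊜ (a ⊕ c) ⊕ (b ⊕ d)) refl (f x) (g x) (∑ xs f) (∑ xs g))

    ∑-homo : ∀ (φ : Carrier → Carrier) → φ ε ≈ ε → (∀ x y → φ (x ∙ y) ≈ φ x ∙ φ y) →
             ∀ (xs : List A) (f : A → Carrier) → φ (∑ xs f) ≈ ∑ xs (φ ∘ f)
    ∑-homo φ φε φ∙ []       f = φε
    ∑-homo φ φε φ∙ (x ∷ xs) f = trans (φ∙ (f x) (∑ xs f)) (∙-congˡ (∑-homo φ φε φ∙ xs f))

  ∑-map : ∀ {A B : Set} (g : A → B) (xs : List A) (f : B → Carrier) → ∑ (map g xs) f ≡ ∑ xs (f ∘ g)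
  ∑-map g xs f = ≡.cong (foldr _∙_ ε) (≡.sym (map-∘ xs))

  ∑ᵃᵈ : ℕ → (ℕ → ℕ → Carrier) → Carrier
  ∑ᵃᵈ zero    h = h 0 0
  ∑ᵃᵈ (suc m) h = h 0 (suc m) ∙ ∑ᵃᵈ m (λ a b → h (suc a) b)

  syntax ∑ᵃᵈ m (λ a b → e) = ∑[ a + b ≡ m ] e

  ∑ᵃᵈ-cong : ∀ m {h h′ : ℕ → ℕ → Carrier} → (∀ a b → a +ℕ b ≡ m → h a b ≈ h′ a b) → ∑ᵃᵈ m h ≈ ∑ᵃᵈ m h′
  ∑ᵃᵈ-cong zero    h≈h′ = h≈h′ 0 0 ≡.refl
  ∑ᵃᵈ-cong (suc m) h≈h′ = ∙-cong (h≈h′ 0 (suc m) ≡.refl) (∑ᵃᵈ-cong m (λ a b e → h≈h′ (suc a) b (≡.cong suc e)))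

  ∑ᵃᵈ-distrib-∙ : ∀ m (h g : ℕ → ℕ → Carrier) → ∑[ a + b ≡ m ] (h a b ∙ g a b) ≈ ∑ᵃᵈ m h ∙ ∑ᵃᵈ m g
  ∑ᵃᵈ-distrib-∙ zero    h g = refl
  ∑ᵃᵈ-distrib-∙ (suc m) h g = trans (∙-congˡ (∑ᵃᵈ-distrib-∙ m (λ a b → h (suc a) b) (λ a b → g (suc a) b)))
    (solve 4 (λ a b c d → (a ⊕ b) ⊕ (c ⊕ d) ⊜ (a ⊕ c) ⊕ (b ⊕ d)) refl
      (h 0 (suc m)) (g 0 (suc m)) (∑ᵃᵈ m (λ a b → h (suc a) b)) (∑ᵃᵈ m (λ a b → g (suc a) b)))

  ∑ᵃᵈ-homo : ∀ (φ : Carrier → Carrier) → (∀ x y → φ (x ∙ y) ≈ φ x ∙ φ y) →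
             ∀ m (h : ℕ → ℕ → Carrier) → φ (∑ᵃᵈ m h) ≈ ∑[ a + b ≡ m ] φ (h a b)
  ∑ᵃᵈ-homo φ φ∙ zero    h = refl
  ∑ᵃᵈ-homo φ φ∙ (suc m) h = trans (φ∙ _ _) (∙-congˡ (∑ᵃᵈ-homo φ φ∙ m (λ a b → h (suc a) b)))

  ∑ᵃᵈ-unfoldʳ : ∀ m (h : ℕ → ℕ → Carrier) → ∑ᵃᵈ (suc m) h ≈ (∑[ a + b ≡ m ] h a (suc b)) ∙ h (suc m) 0
  ∑ᵃᵈ-unfoldʳ zero    h = refl
  ∑ᵃᵈ-unfoldʳ (suc m) h = trans (∙-congˡ (∑ᵃᵈ-unfoldʳ m (λ a b → h (suc a) b))) (sym (assoc _ _ _))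

  ∑ᵃᵈ-extract₀ : ∀ m {h h′ : ℕ → ℕ → Carrier} → (∀ b → h′ 0 b ≈ ε) → (∀ a b → h (suc a) b ≈ h′ (suc a) b) →
                 ∑ᵃᵈ m h ≈ h 0 m ∙ ∑ᵃᵈ m h′
  ∑ᵃᵈ-extract₀ zero    h′₀≈ε h≈h′ = sym (trans (∙-congˡ (h′₀≈ε 0)) (identityʳ _))
  ∑ᵃᵈ-extract₀ (suc m) {h} {h′} h′₀≈ε h≈h′ = ∙-congˡ (begin
    ∑[ a + b ≡ m ] h (suc a) b                ≈⟨ ∑ᵃᵈ-cong m (λ a b _ → h≈h′ a b) ⟩
    ∑[ a + b ≡ m ] h′ (suc a) b               ≈⟨ identityˡ _ ⟨
    ε ∙ ∑[ a + b ≡ m ] h′ (suc a) b           ≈⟨ ∙-congʳ (h′₀≈ε (suc m)) ⟨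
    h′ 0 (suc m) ∙ ∑[ a + b ≡ m ] h′ (suc a) b ∎)

module FieldArithmetic {c ℓ} (F : Field c ℓ) (χ : CharZero F) where
  open Field F
  open Notation F χ using (invℕ)
  open import Algebra.Properties.Semiring.Mult semiring using (×1-homo-*) renaming (_×_ to _×ₘ_)
  open import Algebra.Solver.Ring.NaturalCoefficients.Default commutativeSemiring using (solve; _:*_; _:=_)
  open import Relation.Binary.Reasoning.Setoid setoid

  fromℕ≡×1# : ∀ n → fromℕ F n ≡ n ×ₘ 1#
  fromℕ≡×1# zero    = ≡.refl
  fromℕ≡×1# (suc n) = ≡.cong (1# +_) (fromℕ≡×1# n)

  fromℕ-* : ∀ m n → fromℕ F (m *ℕ n) ≈ fromℕ F m * fromℕ F n
  fromℕ-* m n rewrite fromℕ≡×1# (m *ℕ n) | fromℕ≡×1# m | fromℕ≡×1# n = ×1-homo-* m n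

  fromℕ-invℕ : ∀ n → fromℕ F (suc n) * invℕ (suc n) ≈ 1#
  fromℕ-invℕ n = proj₂ (inverse (fromℕ F (suc n)) (χ n))

  inverse-unique : ∀ x y z → x * y ≈ 1# → x * z ≈ 1# → y ≈ z
  inverse-unique x y z xy≈1 xz≈1 = begin
    y             ≈⟨ *-identityʳ y ⟨
    y * 1#        ≈⟨ *-congˡ xz≈1 ⟨
    y * (x * z)   ≈⟨ *-assoc y x z ⟨
    y * x * z     ≈⟨ *-congʳ (trans (*-comm y x) xy≈1) ⟩
    1# * z        ≈⟨ *-identityˡ z ⟩
    z             ∎

  invℕ-* : ∀ m n → invℕ (m *ℕ n) ≈ invℕ m * invℕ n
  invℕ-* zero    n       = sym (zeroˡ (invℕ n))
  invℕ-* (suc m) zero    = trans (reflexive (≡.cong invℕ (ℕ.*-zeroʳ m))) (sym (zeroʳ (invℕ (suc m))))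
  invℕ-* (suc m) (suc n) = inverse-unique (fromℕ F (suc m *ℕ suc n)) _ _ (fromℕ-invℕ (n +ℕ m *ℕ suc n)) (begin
    fromℕ F (suc m *ℕ suc n) * (invℕ (suc m) * invℕ (suc n))
      ≈⟨ *-congʳ (fromℕ-* (suc m) (suc n)) ⟩
    fromℕ F (suc m) * fromℕ F (suc n) * (invℕ (suc m) * invℕ (suc n))
      ≈⟨ solve 4 (λ a b x y → a :* b :* (x :* y) := a :* x :* (b :* y)) refl _ _ _ _ ⟩
    fromℕ F (suc m) * invℕ (suc m) * (fromℕ F (suc n) * invℕ (suc n))
      ≈⟨ *-cong (fromℕ-invℕ m) (fromℕ-invℕ n) ⟩
    1# * 1#
      ≈⟨ *-identityˡ 1# ⟩
    1# ∎)

-- Equality in T(X) is equality of all coefficients, so the ring laws are checked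
-- coefficientwise; the coefficient of a product is a convolution over the
-- splittings w = s ++ t of the word.
module FreeAlgebra {c ℓ} (F : Field c ℓ) (χ : CharZero F) where
  open Notation F χ
  open Field F
  open ListSum +-commutativeMonoid
  open import Algebra.Properties.Ring ring using (-0#≈0#; -‿+-comm)
  open import Algebra.Solver.Ring.NaturalCoefficients.Default commutativeSemiring using (solve; _:+_; _:*_; _:=_)
  open import Relation.Binary.Reasoning.Setoid setoid

  δ : Word → Word → Carrier
  δ u w = if does (≡-dec _≟ℕ_ u w) then 1# else 0#

  δ-≡ : ∀ {u w} → u ≡ w → δ u w ≈ 1#
  δ-≡ {u} {w} u≡w with ≡-dec _≟ℕ_ u w
  ... | yes _   = refl
  ... | no  u≢w = ⊥-elim (u≢w u≡w)

  δ-≢ : ∀ {u w} → u ≢ w → δ u w ≈ 0#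
  δ-≢ {u} {w} u≢w with ≡-dec _≟ℕ_ u w
  ... | yes u≡w = ⊥-elim (u≢w u≡w)
  ... | no  _   = refl

  δ-∷ : ∀ x u w → δ (x ∷ u) (x ∷ w) ≈ δ u w
  δ-∷ x u w = by-cases (≡-dec _≟ℕ_ u w)
    where
    by-cases : Dec (u ≡ w) → δ (x ∷ u) (x ∷ w) ≈ δ u w
    by-cases (yes u≡w) = trans (δ-≡ {x ∷ u} {x ∷ w} (≡.cong (x ∷_) u≡w)) (sym (δ-≡ u≡w))
    by-cases (no  u≢w) = trans (δ-≢ {x ∷ u} {x ∷ w} (u≢w ∘ ∷-injectiveʳ)) (sym (δ-≢ u≢w))

  coeff-∷ : ∀ a u p w → coeff ((a , u) ∷ p) w ≈ δ u w * a + coeff p w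
  coeff-∷ a u p w with ≡-dec _≟ℕ_ u w
  ... | yes _ = +-congʳ (sym (*-identityˡ a))
  ... | no  _ = sym (trans (+-congʳ (zeroˡ a)) (+-identityˡ _))

  coeff-++ : ∀ p q w → coeff (p +T q) w ≈ coeff p w + coeff q w
  coeff-++ []            q w = sym (+-identityˡ _)
  coeff-++ ((a , u) ∷ p) q w = begin
    coeff ((a , u) ∷ (p ++ q)) w        ≈⟨ coeff-∷ a u (p ++ q) w ⟩
    δ u w * a + coeff (p ++ q) w        ≈⟨ +-congˡ (coeff-++ p q w) ⟩
    δ u w * a + (coeff p w + coeff q w) ≈⟨ sym (+-assoc _ _ _) ⟩
    (δ u w * a + coeff p w) + coeff q w ≈⟨ +-congʳ (sym (coeff-∷ a u p w)) ⟩
    coeff ((a , u) ∷ p) w + coeff q w   ∎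

  coeff-neg : ∀ p w → coeff (-T p) w ≈ - coeff p w
  coeff-neg []            w = sym -0#≈0#
  coeff-neg ((a , u) ∷ p) w with ≡-dec _≟ℕ_ u w
  ... | yes _ = trans (+-congˡ (coeff-neg p w)) (-‿+-comm a (coeff p w))
  ... | no  _ = coeff-neg p w

  coeff-· : ∀ k p w → coeff (k ·T p) w ≈ k * coeff p w
  coeff-· k []            w = sym (zeroʳ k)
  coeff-· k ((a , u) ∷ p) w with ≡-dec _≟ℕ_ u w
  ... | yes _ = trans (+-congˡ (coeff-· k p w)) (sym (distribˡ k a (coeff p w)))
  ... | no  _ = coeff-· k p w

  splits : Word → List (Word × Word)
  splits []      = [ ([] , []) ]
  splits (x ∷ w) = ([] , x ∷ w) ∷ map (map₁ (x ∷_)) (splits w)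

  infixl 7 _⋆_
  _⋆_ : (Word → Carrier) → (Word → Carrier) → Word → Carrier
  (f ⋆ g) w = ∑[ s ∈ splits w ] (f (proj₁ s) * g (proj₂ s))

  δ-splits : ∀ u v w → (δ u ⋆ δ v) w ≈ δ (u ++ v) w
  δ-splits u v [] = trans (+-identityʳ _) (at-empty u)
    where
    at-empty : ∀ u → δ u [] * δ v [] ≈ δ (u ++ v) []
    at-empty []      = *-identityˡ _
    at-empty (_ ∷ _) = zeroˡ _
  δ-splits u v (x ∷ w) = begin
    δ u [] * δ v (x ∷ w) + ∑ (map (map₁ (x ∷_)) (splits w)) (λ s → δ u (proj₁ s) * δ v (proj₂ s))
      ≡⟨ ≡.cong (δ u [] * δ v (x ∷ w) +_) (∑-map (map₁ (x ∷_)) (splits w) (λ s → δ u (proj₁ s) * δ v (proj₂ s))) ⟩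
    δ u [] * δ v (x ∷ w) + ∑[ s ∈ splits w ] (δ u (x ∷ proj₁ s) * δ v (proj₂ s))
      ≈⟨ at-cons u ⟩
    δ (u ++ v) (x ∷ w) ∎
    where
    at-cons : ∀ u → δ u [] * δ v (x ∷ w) + ∑[ s ∈ splits w ] (δ u (x ∷ proj₁ s) * δ v (proj₂ s)) ≈ δ (u ++ v) (x ∷ w)
    at-cons [] = trans (+-cong (*-identityˡ _) (∑-zero (splits w) (λ _ → zeroˡ _))) (+-identityʳ _)
    at-cons (y ∷ u) = trans (+-cong (zeroˡ _) (by-cases (y ≟ℕ x))) (+-identityˡ _)
      where
      by-cases : Dec (y ≡ x) → ∑[ s ∈ splits w ] (δ (y ∷ u) (x ∷ proj₁ s) * δ v (proj₂ s)) ≈ δ (y ∷ u ++ v) (x ∷ w)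
      by-cases (yes ≡.refl) = begin
        ∑[ s ∈ splits w ] (δ (y ∷ u) (y ∷ proj₁ s) * δ v (proj₂ s)) ≈⟨ ∑-cong (splits w) (λ s → *-congʳ (δ-∷ y u (proj₁ s))) ⟩
        (δ u ⋆ δ v) w                                              ≈⟨ δ-splits u v w ⟩
        δ (u ++ v) w                                               ≈⟨ δ-∷ y (u ++ v) w ⟨
        δ (y ∷ u ++ v) (y ∷ w)                                     ∎
      by-cases (no y≢x) = trans (∑-zero (splits w) (λ s → trans (*-congʳ (δ-≢ {y ∷ u} {x ∷ proj₁ s} (y≢x ∘ ∷-injectiveˡ))) (zeroˡ _)))
                                (sym (δ-≢ {y ∷ u ++ v} {x ∷ w} (y≢x ∘ ∷-injectiveˡ)))

  leftMul : Carrier → Word → Carrier × Word → Carrier × Word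
  leftMul a u (b , v) = (a * b , u ++ v)

  coeff-leftMul : ∀ a u q w → coeff (map (leftMul a u) q) w ≈ ((λ s → δ u s * a) ⋆ coeff q) w
  coeff-leftMul a u []            w = sym (∑-zero (splits w) (λ _ → zeroʳ _))
  coeff-leftMul a u ((b , v) ∷ q) w = begin
    coeff ((a * b , u ++ v) ∷ map (leftMul a u) q) w
      ≈⟨ coeff-∷ (a * b) (u ++ v) _ w ⟩
    δ (u ++ v) w * (a * b) + coeff (map (leftMul a u) q) w
      ≈⟨ +-cong (*-congʳ (sym (δ-splits u v w))) (coeff-leftMul a u q w) ⟩
    (δ u ⋆ δ v) w * (a * b) + ((λ s → δ u s * a) ⋆ coeff q) w
      ≈⟨ +-congʳ (∑-homo (_* (a * b)) (zeroˡ _) (λ x y → distribʳ _ x y) (splits w) _) ⟩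
    ∑[ s ∈ splits w ] (δ u (proj₁ s) * δ v (proj₂ s) * (a * b)) + ((λ s → δ u s * a) ⋆ coeff q) w
      ≈⟨ ∑-distrib-∙ (splits w) _ _ ⟨
    ∑[ s ∈ splits w ] (δ u (proj₁ s) * δ v (proj₂ s) * (a * b) + δ u (proj₁ s) * a * coeff q (proj₂ s))
      ≈⟨ ∑-cong (splits w) (λ s → regroup (δ u (proj₁ s)) (δ v (proj₂ s)) (coeff q (proj₂ s))) ⟩
    ∑[ s ∈ splits w ] (δ u (proj₁ s) * a * (δ v (proj₂ s) * b + coeff q (proj₂ s)))
      ≈⟨ ∑-cong (splits w) (λ s → *-congˡ (sym (coeff-∷ b v q (proj₂ s)))) ⟩
    ((λ s → δ u s * a) ⋆ coeff ((b , v) ∷ q)) w ∎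
    where
    regroup : ∀ d e r → d * e * (a * b) + d * a * r ≈ d * a * (e * b + r)
    regroup = solve 5 (λ α β d e r → d :* e :* (α :* β) :+ d :* α :* r := d :* α :* (e :* β :+ r)) refl a b

  coeff-* : ∀ p q w → coeff (p *T q) w ≈ (coeff p ⋆ coeff q) w
  coeff-* []            q w = sym (∑-zero (splits w) (λ _ → zeroˡ _))
  coeff-* ((a , u) ∷ p) q w = begin
    coeff (map (leftMul a u) q ++ (p *T q)) w
      ≈⟨ coeff-++ (map (leftMul a u) q) (p *T q) w ⟩
    coeff (map (leftMul a u) q) w + coeff (p *T q) w
      ≈⟨ +-cong (coeff-leftMul a u q w) (coeff-* p q w) ⟩
    ((λ s → δ u s * a) ⋆ coeff q) w + (coeff p ⋆ coeff q) w
      ≈⟨ ∑-distrib-∙ (splits w) _ _ ⟨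
    ∑[ s ∈ splits w ] (δ u (proj₁ s) * a * coeff q (proj₂ s) + coeff p (proj₁ s) * coeff q (proj₂ s))
      ≈⟨ ∑-cong (splits w) (λ s → trans (sym (distribʳ _ _ _)) (*-congʳ (sym (coeff-∷ a u p (proj₁ s))))) ⟩
    (coeff ((a , u) ∷ p) ⋆ coeff q) w ∎

  -- A record rather than _≈T_ itself, so that both sides can be inferred by unification.
  infix 4 _≋_
  record _≋_ (p q : T) : Set ℓ where
    constructor coeffwise
    field coeff-≈ : p ≈T q
  open _≋_ public

  ≋-isEquivalence : IsEquivalence _≋_
  ≋-isEquivalence = record
    { refl  = coeffwise (λ _ → refl)
    ; sym   = λ p≋q → coeffwise (λ w → sym (coeff-≈ p≋q w))
    ; trans = λ p≋q q≋r → coeffwise (λ w → trans (coeff-≈ p≋q w) (coeff-≈ q≋r w))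
    }

  open IsEquivalence ≋-isEquivalence using () renaming (refl to ≋-refl; trans to ≋-trans; reflexive to ≋-reflexive)

  map-≋ : ∀ {f g : Carrier × Word → Carrier × Word} →
          (∀ m → proj₁ (f m) ≈ proj₁ (g m)) → (∀ m → proj₂ (f m) ≡ proj₂ (g m)) → ∀ p → map f p ≋ map g p
  map-≋ {f} {g} f₁≈g₁ f₂≡g₂ p = coeffwise (go p)
    where
    go : ∀ p → map f p ≈T map g p
    go []      w = refl
    go (m ∷ p) w = begin
      coeff (f m ∷ map f p) w
        ≈⟨ coeff-∷ (proj₁ (f m)) (proj₂ (f m)) (map f p) w ⟩
      δ (proj₂ (f m)) w * proj₁ (f m) + coeff (map f p) w
        ≈⟨ +-cong (*-cong (reflexive (≡.cong (λ u → δ u w) (f₂≡g₂ m))) (f₁≈g₁ m)) (go p w) ⟩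
      δ (proj₂ (g m)) w * proj₁ (g m) + coeff (map g p) w
        ≈⟨ coeff-∷ (proj₁ (g m)) (proj₂ (g m)) (map g p) w ⟨
      coeff (g m ∷ map g p) w ∎

  +T-cong : ∀ {p p′ q q′} → p ≋ p′ → q ≋ q′ → p +T q ≋ p′ +T q′
  +T-cong {p} {p′} {q} {q′} p≋p′ q≋q′ = coeffwise λ w → begin
    coeff (p +T q) w          ≈⟨ coeff-++ p q w ⟩
    coeff p w + coeff q w     ≈⟨ +-cong (coeff-≈ p≋p′ w) (coeff-≈ q≋q′ w) ⟩
    coeff p′ w + coeff q′ w   ≈⟨ coeff-++ p′ q′ w ⟨
    coeff (p′ +T q′) w        ∎

  +T-comm : ∀ p q → p +T q ≋ q +T p
  +T-comm p q = coeffwise λ w → trans (coeff-++ p q w) (trans (+-comm _ _) (sym (coeff-++ q p w)))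

  -T-cong : ∀ {p q} → p ≋ q → -T p ≋ -T q
  -T-cong {p} {q} p≋q = coeffwise λ w → trans (coeff-neg p w) (trans (-‿cong (coeff-≈ p≋q w)) (sym (coeff-neg q w)))

  -T-inverseˡ : ∀ p → (-T p) +T p ≋ 0T
  -T-inverseˡ p = coeffwise λ w → trans (coeff-++ (-T p) p w) (trans (+-congʳ (coeff-neg p w)) (-‿inverseˡ _))

  -T-inverseʳ : ∀ p → p +T (-T p) ≋ 0T
  -T-inverseʳ p = coeffwise λ w → trans (coeff-++ p (-T p) w) (trans (+-congˡ (coeff-neg p w)) (-‿inverseʳ _))

  *T-cong : ∀ {p p′ q q′} → p ≋ p′ → q ≋ q′ → p *T q ≋ p′ *T q′
  *T-cong {p} {p′} {q} {q′} p≋p′ q≋q′ = coeffwise λ w → begin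
    coeff (p *T q) w         ≈⟨ coeff-* p q w ⟩
    (coeff p ⋆ coeff q) w    ≈⟨ ∑-cong (splits w) (λ s → *-cong (coeff-≈ p≋p′ (proj₁ s)) (coeff-≈ q≋q′ (proj₂ s))) ⟩
    (coeff p′ ⋆ coeff q′) w  ≈⟨ coeff-* p′ q′ w ⟨
    coeff (p′ *T q′) w       ∎

  *T-distribˡ : ∀ p q r → p *T (q +T r) ≋ (p *T q) +T (p *T r)
  *T-distribˡ p q r = coeffwise λ w → begin
    coeff (p *T (q +T r)) w
      ≈⟨ coeff-* p (q +T r) w ⟩
    (coeff p ⋆ coeff (q +T r)) w
      ≈⟨ ∑-cong (splits w) (λ s → trans (*-congˡ (coeff-++ q r (proj₂ s))) (distribˡ _ _ _)) ⟩
    ∑[ s ∈ splits w ] (coeff p (proj₁ s) * coeff q (proj₂ s) + coeff p (proj₁ s) * coeff r (proj₂ s))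
      ≈⟨ ∑-distrib-∙ (splits w) _ _ ⟩
    (coeff p ⋆ coeff q) w + (coeff p ⋆ coeff r) w
      ≈⟨ +-cong (coeff-* p q w) (coeff-* p r w) ⟨
    coeff (p *T q) w + coeff (p *T r) w
      ≈⟨ coeff-++ (p *T q) (p *T r) w ⟨
    coeff ((p *T q) +T (p *T r)) w ∎

  *T-distribʳ : ∀ p q r → (q +T r) *T p ≋ (q *T p) +T (r *T p)
  *T-distribʳ p q r = coeffwise λ w → begin
    coeff ((q +T r) *T p) w
      ≈⟨ coeff-* (q +T r) p w ⟩
    (coeff (q +T r) ⋆ coeff p) w
      ≈⟨ ∑-cong (splits w) (λ s → trans (*-congʳ (coeff-++ q r (proj₁ s))) (distribʳ _ _ _)) ⟩
    ∑[ s ∈ splits w ] (coeff q (proj₁ s) * coeff p (proj₂ s) + coeff r (proj₁ s) * coeff p (proj₂ s))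
      ≈⟨ ∑-distrib-∙ (splits w) _ _ ⟩
    (coeff q ⋆ coeff p) w + (coeff r ⋆ coeff p) w
      ≈⟨ +-cong (coeff-* q p w) (coeff-* r p w) ⟨
    coeff (q *T p) w + coeff (r *T p) w
      ≈⟨ coeff-++ (q *T p) (r *T p) w ⟨
    coeff ((q *T p) +T (r *T p)) w ∎

  *T-identityˡ : ∀ p → 1T *T p ≋ p
  *T-identityˡ p = ≋-trans (≋-reflexive (++-identityʳ _))
    (≋-trans (map-≋ (λ _ → *-identityˡ _) (λ _ → ≡.refl) p) (≋-reflexive (map-id p)))

  *T-identityʳ : ∀ p → p *T 1T ≋ p
  *T-identityʳ p = ≋-trans (≋-reflexive (≡.trans (≡.cong concat (map-∘ p)) (concat-map-[ map _ p ])))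
    (≋-trans (map-≋ (λ _ → *-identityʳ _) (λ m → ++-identityʳ (proj₂ m)) p) (≋-reflexive (map-id p)))

  leftMul-assoc : ∀ a u b v r → map (leftMul (a * b) (u ++ v)) r ≋ map (leftMul a u) (map (leftMul b v) r)
  leftMul-assoc a u b v r = ≋-trans (map-≋ (λ m → *-assoc a b (proj₁ m)) (λ m → ++-assoc u v (proj₂ m)) r)
                                    (≋-reflexive (map-∘ r))

  leftMul-*T : ∀ a u q r → map (leftMul a u) q *T r ≋ map (leftMul a u) (q *T r)
  leftMul-*T a u []            r = ≋-refl
  leftMul-*T a u ((b , v) ∷ q) r = ≋-trans (+T-cong (leftMul-assoc a u b v r) (leftMul-*T a u q r))
                                           (≋-reflexive (≡.sym (map-++ (leftMul a u) (map (leftMul b v) r) (q *T r))))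

  *T-assoc : ∀ p q r → (p *T q) *T r ≋ p *T (q *T r)
  *T-assoc []            q r = ≋-refl
  *T-assoc ((a , u) ∷ p) q r =
    ≋-trans (*T-distribʳ r (map (leftMul a u) q) (p *T q)) (+T-cong (leftMul-*T a u q r) (*T-assoc p q r))

  T-ring : Ring c ℓ
  T-ring = record
    { Carrier = T ; _≈_ = _≋_ ; _+_ = _+T_ ; _*_ = _*T_ ; -_ = -T_ ; 0# = 0T ; 1# = 1T
    ; isRing = record
      { +-isAbelianGroup = record
        { isGroup = record
          { isMonoid = record
            { isSemigroup = record
              { isMagma = record { isEquivalence = ≋-isEquivalence ; ∙-cong = +T-cong }
              ; assoc   = λ p q r → ≋-reflexive (++-assoc p q r)
              }
            ; identity = (λ _ → ≋-refl) , (λ p → ≋-reflexive (++-identityʳ p))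
            }
          ; inverse = -T-inverseˡ , -T-inverseʳ
          ; ⁻¹-cong = -T-cong
          }
        ; comm = +T-comm
        }
      ; *-cong     = *T-cong
      ; *-assoc    = *T-assoc
      ; *-identity = *T-identityˡ , *T-identityʳ
      ; distrib    = *T-distribˡ , *T-distribʳ
      }
    }

  ·T-cong : ∀ {k l p q} → k ≈ l → p ≋ q → k ·T p ≋ l ·T q
  ·T-cong {k} {l} {p} {q} k≈l p≋q = coeffwise λ w →
    trans (coeff-· k p w) (trans (*-cong k≈l (coeff-≈ p≋q w)) (sym (coeff-· l q w)))

  ·T-distribˡ : ∀ k p q → k ·T (p +T q) ≋ (k ·T p) +T (k ·T q)
  ·T-distribˡ k p q = coeffwise λ w → begin
    coeff (k ·T (p +T q)) w                ≈⟨ coeff-· k (p +T q) w ⟩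
    k * coeff (p +T q) w                   ≈⟨ *-congˡ (coeff-++ p q w) ⟩
    k * (coeff p w + coeff q w)            ≈⟨ distribˡ k _ _ ⟩
    k * coeff p w + k * coeff q w          ≈⟨ +-cong (coeff-· k p w) (coeff-· k q w) ⟨
    coeff (k ·T p) w + coeff (k ·T q) w    ≈⟨ coeff-++ (k ·T p) (k ·T q) w ⟨
    coeff ((k ·T p) +T (k ·T q)) w         ∎

  ·T-distribʳ : ∀ k l p → (k + l) ·T p ≋ (k ·T p) +T (l ·T p)
  ·T-distribʳ k l p = coeffwise λ w → begin
    coeff ((k + l) ·T p) w                 ≈⟨ coeff-· (k + l) p w ⟩
    (k + l) * coeff p w                    ≈⟨ distribʳ _ k l ⟩
    k * coeff p w + l * coeff p w          ≈⟨ +-cong (coeff-· k p w) (coeff-· l p w) ⟨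
    coeff (k ·T p) w + coeff (l ·T p) w    ≈⟨ coeff-++ (k ·T p) (l ·T p) w ⟨
    coeff ((k ·T p) +T (l ·T p)) w         ∎

  ·T-assoc : ∀ k l p → (k * l) ·T p ≋ k ·T (l ·T p)
  ·T-assoc k l p = coeffwise λ w → begin
    coeff ((k * l) ·T p) w     ≈⟨ coeff-· (k * l) p w ⟩
    k * l * coeff p w          ≈⟨ *-assoc k l _ ⟩
    k * (l * coeff p w)        ≈⟨ *-congˡ (coeff-· l p w) ⟨
    k * coeff (l ·T p) w       ≈⟨ coeff-· k (l ·T p) w ⟨
    coeff (k ·T (l ·T p)) w    ∎

  ·T-identityˡ : ∀ p → 1# ·T p ≋ p
  ·T-identityˡ p = coeffwise λ w → trans (coeff-· 1# p w) (*-identityˡ _)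

  ·T-*T-assoc : ∀ k p q → (k ·T p) *T q ≋ k ·T (p *T q)
  ·T-*T-assoc k p q = coeffwise λ w → begin
    coeff ((k ·T p) *T q) w
      ≈⟨ coeff-* (k ·T p) q w ⟩
    (coeff (k ·T p) ⋆ coeff q) w
      ≈⟨ ∑-cong (splits w) (λ s → trans (*-congʳ (coeff-· k p (proj₁ s))) (*-assoc _ _ _)) ⟩
    ∑[ s ∈ splits w ] (k * (coeff p (proj₁ s) * coeff q (proj₂ s)))
      ≈⟨ ∑-homo (k *_) (zeroʳ k) (distribˡ k) (splits w) _ ⟨
    k * (coeff p ⋆ coeff q) w
      ≈⟨ *-congˡ (coeff-* p q w) ⟨
    k * coeff (p *T q) w
      ≈⟨ coeff-· k (p *T q) w ⟨
    coeff (k ·T (p *T q)) w ∎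

module PartialSums {c ℓ} (F : Field c ℓ) (χ : CharZero F) where
  open Notation F χ
  open FreeAlgebra F χ using (_≋_; T-ring; ·T-distribˡ)
  open Ring T-ring hiding (zero)
  open import Algebra.Solver.CommutativeMonoid +-commutativeMonoid using (solve; _⊕_; _⊜_)
  open import Relation.Binary.Reasoning.Setoid setoid

  psum-cong : ∀ {a b} → (∀ m → a m ≋ b m) → ∀ m → psum a m ≋ psum b m
  psum-cong a≈b zero    = a≈b zero
  psum-cong a≈b (suc m) = +-cong (psum-cong a≈b m) (a≈b (suc m))

  psum-+ : ∀ a b m → psum (a +A b) m ≋ psum a m +T psum b m
  psum-+ a b zero    = refl
  psum-+ a b (suc m) = trans (+-congʳ (psum-+ a b m))
    (solve 4 (λ x y z u → (x ⊕ y) ⊕ (z ⊕ u) ⊜ (x ⊕ z) ⊕ (y ⊕ u)) refl (psum a m) (psum b m) (a (suc m)) (b (suc m)))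

  psum-· : ∀ k a m → psum (k ·A a) m ≋ k ·T psum a m
  psum-· k a zero    = refl
  psum-· k a (suc m) = trans (+-congʳ (psum-· k a m)) (sym (·T-distribˡ k (psum a m) (a (suc m))))

  psum-∗ρ : ∀ a b m → psum a m *T psum b m ≋ psum (a ∗ρ b) m
  psum-∗ρ a b zero    = sym (trans (+-congʳ (zeroʳ (a zero))) (+-identityˡ _))
  psum-∗ρ a b (suc m) = begin
    (Pa +T a′) *T (Pb +T b′)                                    ≈⟨ distribˡ (Pa +T a′) Pb b′ ⟩
    ((Pa +T a′) *T Pb) +T ((Pa +T a′) *T b′)                    ≈⟨ +-cong (distribʳ Pb Pa a′) (distribʳ b′ Pa a′) ⟩
    ((Pa *T Pb) +T (a′ *T Pb)) +T ((Pa *T b′) +T (a′ *T b′))    ≈⟨ solve 4 (λ x y z u → (x ⊕ y) ⊕ (z ⊕ u) ⊜ x ⊕ ((z ⊕ y) ⊕ u)) refl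
                                                                     (Pa *T Pb) (a′ *T Pb) (Pa *T b′) (a′ *T b′) ⟩
    (Pa *T Pb) +T (((Pa *T b′) +T (a′ *T Pb)) +T (a′ *T b′))    ≈⟨ +-congʳ (psum-∗ρ a b m) ⟩
    psum (a ∗ρ b) (suc m)                                       ∎
    where
    Pa = psum a m ; Pb = psum b m ; a′ = a (suc m) ; b′ = b (suc m)

module SequenceAlgebra {c ℓ} (F : Field c ℓ) (χ : CharZero F) where
  open Notation F χ
  open FreeAlgebra F χ using (_≋_; T-ring; ·T-cong; ·T-distribˡ; ·T-distribʳ; ·T-assoc; ·T-identityˡ; ·T-*T-assoc)
  module K = Field F
  open Ring T-ring using () renaming (refl to ≋-refl)

  -- The operations of 𝒜 reduce pointwise to list operations, which blocks unification;
  -- implicit arguments of congruence lemmas below are therefore often given explicitly.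
  𝒜-ring : Ring c ℓ
  𝒜-ring = Pointwise.ring ℕ T-ring

  open Ring 𝒜-ring public using (_≈_; -_; refl; sym; trans; setoid; +-cong; +-congˡ; +-congʳ; +-assoc; +-comm; +-identityʳ;
    *-congˡ; *-congʳ; *-assoc; *-identityˡ; distribˡ; distribʳ; +-commutativeMonoid)
  open import Algebra.Properties.Ring 𝒜-ring using (x+x≈x⇒x≈0)
  open PartialSums F χ
  open FieldArithmetic F χ using (fromℕ-invℕ)
  open ListSum +-commutativeMonoid
  open import Relation.Binary.Reasoning.Setoid setoid

  ·-cong : ∀ {k l a b} → k K.≈ l → a ≈ b → k ·A a ≈ l ·A b
  ·-cong k≈l a≈b m = ·T-cong k≈l (a≈b m)

  ·-distribˡ : ∀ k a b → k ·A (a +A b) ≈ k ·A a +A k ·A b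
  ·-distribˡ k a b m = ·T-distribˡ k (a m) (b m)

  ·-distribʳ : ∀ k l a → (k K.+ l) ·A a ≈ k ·A a +A l ·A a
  ·-distribʳ k l a m = ·T-distribʳ k l (a m)

  ·-assoc : ∀ k l a → (k K.* l) ·A a ≈ k ·A l ·A a
  ·-assoc k l a m = ·T-assoc k l (a m)

  ·-identityˡ : ∀ a → K.1# ·A a ≈ a
  ·-identityˡ a m = ·T-identityˡ (a m)

  ·-*-assoc : ∀ k a b → (k ·A a) *A b ≈ k ·A (a *A b)
  ·-*-assoc k a b m = ·T-*T-assoc k (a m) (b m)

  ρ-cong : ∀ {a b} → a ≈ b → ρ a ≈ ρ b
  ρ-cong a≈b zero    = ≋-refl
  ρ-cong a≈b (suc m) = psum-cong a≈b m

  ρ-+ : ∀ a b → ρ (a +A b) ≈ ρ a +A ρ b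
  ρ-+ a b zero    = ≋-refl
  ρ-+ a b (suc m) = psum-+ a b m

  ρ-· : ∀ k a → ρ (k ·A a) ≈ k ·A ρ a
  ρ-· k a zero    = ≋-refl
  ρ-· k a (suc m) = psum-· k a m

  ρ-∗ρ : ∀ a b → ρ a *A ρ b ≈ ρ (a ∗ρ b)
  ρ-∗ρ a b zero    = ≋-refl
  ρ-∗ρ a b (suc m) = psum-∗ρ a b m

  ∗ρ-congʳ : ∀ {a a′ x} → a ≈ a′ → a ∗ρ x ≈ a′ ∗ρ x
  ∗ρ-congʳ a≈a′ = +-cong (+-cong (*-congʳ (ρ-cong a≈a′)) (*-congʳ a≈a′)) (*-congʳ a≈a′)

  Additive : (𝒜 → 𝒜) → Set (c ⊔ ℓ)
  Additive φ = ∀ a b → φ (a +A b) ≈ φ a +A φ b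

  ∑-additive : ∀ φ → Additive φ → ∀ {A : Set} (xs : List A) (f : A → 𝒜) → φ (∑ xs f) ≈ ∑ xs (φ ∘ f)
  ∑-additive φ φ-+ = ∑-homo φ (x+x≈x⇒x≈0 (φ 0A) (sym (φ-+ 0A 0A))) φ-+

  *-additive : ∀ b → Additive (_*A b)
  *-additive b = distribʳ b

  ∗ρ-additive : ∀ x → Additive (_∗ρ x)
  ∗ρ-additive x a b = begin
    ρ (a +A b) *A x +A (a +A b) *A ρ x +A (a +A b) *A x
      ≈⟨ +-cong (+-cong (trans (*-congʳ (ρ-+ a b)) (distribʳ x (ρ a) (ρ b))) (distribʳ (ρ x) a b)) (distribʳ x a b) ⟩
    (ρ a *A x +A ρ b *A x) +A (a *A ρ x +A b *A ρ x) +A (a *A x +A b *A x)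
      ≈⟨ solve 6 (λ p q r s t u → ((p ⊕ q) ⊕ (r ⊕ s)) ⊕ (t ⊕ u) ⊜ ((p ⊕ r) ⊕ t) ⊕ ((q ⊕ s) ⊕ u)) refl
           (ρ a *A x) (ρ b *A x) (a *A ρ x) (b *A ρ x) (a *A x) (b *A x) ⟩
    a ∗ρ x +A b ∗ρ x ∎
    where
    open import Algebra.Solver.CommutativeMonoid +-commutativeMonoid using (solve; _⊕_; _⊜_)

  ·-∗ρ-assoc : ∀ k a x → (k ·A a) ∗ρ x ≈ k ·A (a ∗ρ x)
  ·-∗ρ-assoc k a x = begin
    ρ (k ·A a) *A x +A (k ·A a) *A ρ x +A (k ·A a) *A x
      ≈⟨ +-congʳ (+-congʳ (*-congʳ (ρ-· k a))) ⟩
    (k ·A ρ a) *A x +A (k ·A a) *A ρ x +A (k ·A a) *A x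
      ≈⟨ +-cong (+-cong (·-*-assoc k (ρ a) x) (·-*-assoc k a (ρ x))) (·-*-assoc k a x) ⟩
    k ·A (ρ a *A x) +A k ·A (a *A ρ x) +A k ·A (a *A x)
      ≈⟨ trans (·-distribˡ k (ρ a *A x +A a *A ρ x) (a *A x)) (+-congʳ (·-distribˡ k (ρ a *A x) (a *A ρ x))) ⟨
    k ·A (a ∗ρ x) ∎

  fromℕ-suc-· : ∀ n a → fromℕ F (suc n) ·A a ≈ a +A fromℕ F n ·A a
  fromℕ-suc-· n a = trans (·-distribʳ K.1# (fromℕ F n) a) (+-congʳ (·-identityˡ a))

  ·-cancel : ∀ n {a b} → fromℕ F (suc n) ·A a ≈ b → a ≈ invℕ (suc n) ·A b
  ·-cancel n {a} {b} na≈b = begin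
    a                                          ≈⟨ ·-identityˡ a ⟨
    K.1# ·A a                                  ≈⟨ ·-cong (K.trans (K.*-comm _ _) (fromℕ-invℕ n)) refl ⟨
    (invℕ (suc n) K.* fromℕ F (suc n)) ·A a    ≈⟨ ·-assoc _ _ a ⟩
    invℕ (suc n) ·A fromℕ F (suc n) ·A a       ≈⟨ ·-cong K.refl na≈b ⟩
    invℕ (suc n) ·A b                          ∎

module Compositions {c ℓ} (F : Field c ℓ) (χ : CharZero F) where
  open Notation F χ using (compositions; incHead; denomFrom; denom)

  sum-incHead : ∀ {n} is → sum is ≡ suc n → sum (incHead is) ≡ suc (suc n)
  sum-incHead (i ∷ is) sum≡ = ≡.cong suc sum≡

  compositions-sum : ∀ n → All (λ is → sum is ≡ n) (compositions n)
  compositions-sum zero          = ≡.refl ∷ []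
  compositions-sum (suc zero)    = ≡.refl ∷ []
  compositions-sum (suc (suc n)) =
    ++⁺ (map⁺ (All.map (≡.cong suc) (compositions-sum (suc n))))
        (map⁺ (All.map (λ {is} → sum-incHead is) (compositions-sum (suc n))))

  incHead-snoc : ∀ {n} is j → sum is ≡ suc n → incHead (is ++ [ j ]) ≡ incHead is ++ [ j ]
  incHead-snoc (i ∷ is) j _ = ≡.refl

  denomFrom-snoc : ∀ acc is j → denomFrom acc (is ++ [ j ]) ≡ denomFrom acc is *ℕ (acc +ℕ sum is +ℕ j)
  denomFrom-snoc acc []       j = begin
    (acc +ℕ j) *ℕ 1           ≡⟨ ℕ.*-identityʳ (acc +ℕ j) ⟩
    acc +ℕ j                  ≡⟨ ≡.cong (_+ℕ j) (ℕ.+-identityʳ acc) ⟨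
    acc +ℕ 0 +ℕ j             ≡⟨ ℕ.*-identityˡ (acc +ℕ 0 +ℕ j) ⟨
    1 *ℕ (acc +ℕ 0 +ℕ j)      ∎
    where open ≡.≡-Reasoning
  denomFrom-snoc acc (i ∷ is) j = begin
    (acc +ℕ i) *ℕ denomFrom (acc +ℕ i) (is ++ [ j ])                   ≡⟨ ≡.cong ((acc +ℕ i) *ℕ_) (denomFrom-snoc (acc +ℕ i) is j) ⟩
    (acc +ℕ i) *ℕ (denomFrom (acc +ℕ i) is *ℕ (acc +ℕ i +ℕ sum is +ℕ j)) ≡⟨ ℕ.*-assoc (acc +ℕ i) _ _ ⟨
    (acc +ℕ i) *ℕ denomFrom (acc +ℕ i) is *ℕ (acc +ℕ i +ℕ sum is +ℕ j)   ≡⟨ ≡.cong (λ s → (acc +ℕ i) *ℕ denomFrom (acc +ℕ i) is *ℕ (s +ℕ j)) (ℕ.+-assoc acc i (sum is)) ⟩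
    (acc +ℕ i) *ℕ denomFrom (acc +ℕ i) is *ℕ (acc +ℕ (i +ℕ sum is) +ℕ j) ∎
    where open ≡.≡-Reasoning

  denom-snoc : ∀ is j → denom (is ++ [ j ]) ≡ denom is *ℕ (sum is +ℕ j)
  denom-snoc = denomFrom-snoc 0

  compositions⁺ : ℕ → List (List ℕ)
  compositions⁺ zero    = []
  compositions⁺ (suc n) = compositions (suc n)

  compositions-suc : ∀ n → compositions (suc n) ≡ map (1 ∷_) (compositions n) ++ map incHead (compositions⁺ n)
  compositions-suc zero    = ≡.refl
  compositions-suc (suc n) = ≡.refl

  module _ {a ℓ′} (M : CommutativeMonoid a ℓ′) where
    open CommutativeMonoid M
    open ListSum M
    open import Relation.Binary.Reasoning.Setoid setoid

    ∑-compositions-suc : ∀ n (f : List ℕ → Carrier) →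
      ∑ (compositions (suc n)) f ≈ ∑ (compositions n) (f ∘ (1 ∷_)) ∙ ∑ (compositions⁺ n) (f ∘ incHead)
    ∑-compositions-suc n f = begin
      ∑ (compositions (suc n)) f
        ≡⟨ ≡.cong (λ xs → ∑ xs f) (compositions-suc n) ⟩
      ∑ (map (1 ∷_) (compositions n) ++ map incHead (compositions⁺ n)) f
        ≈⟨ ∑-++ (map (1 ∷_) (compositions n)) _ f ⟩
      ∑ (map (1 ∷_) (compositions n)) f ∙ ∑ (map incHead (compositions⁺ n)) f
        ≡⟨ ≡.cong₂ _∙_ (∑-map (1 ∷_) (compositions n) f) (∑-map incHead (compositions⁺ n) f) ⟩
      ∑ (compositions n) (f ∘ (1 ∷_)) ∙ ∑ (compositions⁺ n) (f ∘ incHead) ∎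

    -- Prepending a part 1 and incrementing the first part both commute with appending
    -- the last part, except on the one-part composition [m + 2], which is the a = 0
    -- column of B.
    ∑-compositions-last : ∀ m (f : List ℕ → Carrier) →
      ∑ (compositions (suc m)) f ≈ ∑[ a + b ≡ m ] ∑[ js ∈ compositions a ] f (js ++ [ suc b ])
    ∑-compositions-last zero    f = refl
    ∑-compositions-last (suc m) f = begin
      ∑ (compositions (suc (suc m))) f
        ≈⟨ ∑-compositions-suc (suc m) f ⟩
      ∑ (compositions (suc m)) (f ∘ (1 ∷_)) ∙ ∑ (compositions (suc m)) (f ∘ incHead)
        ≈⟨ ∙-cong (∑-compositions-last m (f ∘ (1 ∷_))) (∑-compositions-last m (f ∘ incHead)) ⟩
      ∑ᵃᵈ m A ∙ ∑ᵃᵈ m B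
        ≈⟨ ∙-congˡ (∑ᵃᵈ-extract₀ m (λ _ → refl) B≈B⁺) ⟩
      ∑ᵃᵈ m A ∙ (B 0 m ∙ ∑ᵃᵈ m B⁺)
        ≈⟨ solve 3 (λ x y z → x ⊕ (y ⊕ z) ⊜ y ⊕ (x ⊕ z)) refl (∑ᵃᵈ m A) (B 0 m) (∑ᵃᵈ m B⁺) ⟩
      B 0 m ∙ (∑ᵃᵈ m A ∙ ∑ᵃᵈ m B⁺)
        ≈⟨ ∙-congˡ (∑ᵃᵈ-distrib-∙ m A B⁺) ⟨
      B 0 m ∙ ∑[ a + b ≡ m ] (A a b ∙ B⁺ a b)
        ≈⟨ ∙-congˡ (∑ᵃᵈ-cong m (λ a b _ → ∑-compositions-suc a (λ js → f (js ++ [ suc b ])))) ⟨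
      ∑[ a + b ≡ suc m ] ∑[ js ∈ compositions a ] f (js ++ [ suc b ]) ∎
      where
      open import Algebra.Solver.CommutativeMonoid M using (solve; _⊕_; _⊜_)
      A B B⁺ : ℕ → ℕ → Carrier
      A  a b = ∑[ js ∈ compositions a ] f (1 ∷ js ++ [ suc b ])
      B  a b = ∑[ js ∈ compositions a ] f (incHead (js ++ [ suc b ]))
      B⁺ a b = ∑[ js ∈ compositions⁺ a ] f (incHead js ++ [ suc b ])
      B≈B⁺ : ∀ a b → B (suc a) b ≈ B⁺ (suc a) b
      B≈B⁺ a b = ∑-cong-All (compositions-sum (suc a)) (λ {js} sum≡ → reflexive (≡.cong f (incHead-snoc js (suc b) sum≡)))

module Expansion {c ℓ} (F : Field c ℓ) (χ : CharZero F) where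
  open Notation F χ
  open SequenceAlgebra F χ
  open FieldArithmetic F χ using (invℕ-*)
  open Compositions F χ using (compositions-sum; denom-snoc; ∑-compositions-last)
  open ListSum +-commutativeMonoid
  open import Algebra.Properties.Ring 𝒜-ring using (-‿+-comm; //-rightDividesˡ)
  open import Relation.Binary.Reasoning.Setoid setoid

  C : ℕ → 𝒜
  C j = cpow j 𝕏

  recurrence : (ℕ → 𝒜) → ℕ → 𝒜
  recurrence Y zero    = 𝕏
  recurrence Y (suc k) = C (suc (suc k)) +A ∑[ a + b ≡ k ] (Y a ∗ρ C (suc b))

  recurrence-cong : ∀ {Y Z} m → (∀ {a} → a < m → Y a ≈ Z a) → recurrence Y m ≈ recurrence Z m
  recurrence-cong zero    Y≈Z = refl
  recurrence-cong (suc k) Y≈Z = +-congˡ (∑ᵃᵈ-cong k (λ a b a+b≡k →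
    ∗ρ-congʳ (Y≈Z (s≤s (≡.subst (a ≤_) a+b≡k (ℕ.m≤m+n a b))))))

  SolvesRecurrence : (ℕ → 𝒜) → Set ℓ
  SolvesRecurrence Y = ∀ m → Y m ≈ invℕ (suc m) ·A recurrence Y m

  recurrence-unique : ∀ {Y Z} → SolvesRecurrence Y → SolvesRecurrence Z → ∀ m → Y m ≈ Z m
  recurrence-unique {Y} {Z} Y-solves Z-solves = <-rec (λ m → Y m ≈ Z m) λ m Y≈Z-below → begin
    Y m                               ≈⟨ Y-solves m ⟩
    invℕ (suc m) ·A recurrence Y m    ≈⟨ ·-cong K.refl (recurrence-cong m Y≈Z-below) ⟩
    invℕ (suc m) ·A recurrence Z m    ≈⟨ Z-solves m ⟨
    Z m                               ∎

  ρcpow𝕏-expansion : ∀ j → ρ (C (suc j)) *A 𝕏 ≈ C (suc (suc j)) +A (𝕏 *A ρ (C (suc j)) +A 𝕏 *A C (suc j))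
  ρcpow𝕏-expansion j = sym (begin
    y -A u -A v +A (u +A v)     ≈⟨ +-congʳ (trans (+-assoc y (- u) (- v)) (+-congˡ {y} (-‿+-comm u v))) ⟩
    y -A (u +A v) +A (u +A v)   ≈⟨ //-rightDividesˡ (u +A v) y ⟩
    y                           ∎)
    where
    y u v : 𝒜
    y = ρ (C (suc j)) *A 𝕏
    u = 𝕏 *A ρ (C (suc j))
    v = 𝕏 *A C (suc j)

  ρpow*𝕏 : ℕ → 𝒜
  ρpow*𝕏 n = ρpow n *A 𝕏

  common : ℕ → ℕ → 𝒜
  common a b = ρpow*𝕏 a *A ρ (C (suc b)) +A ρpow*𝕏 a *A C (suc b)

  ρpow*ρcpow*𝕏-expansion : ∀ a b → ρpow a *A ρ (C (suc b)) *A 𝕏 ≈ ρpow a *A C (suc (suc b)) +A common a b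
  ρpow*ρcpow*𝕏-expansion a b = begin
    W *A ρ Cb *A 𝕏
      ≈⟨ *-assoc W (ρ Cb) 𝕏 ⟩
    W *A (ρ Cb *A 𝕏)
      ≈⟨ *-congˡ {W} (ρcpow𝕏-expansion b) ⟩
    W *A (Cb′ +A (𝕏 *A ρ Cb +A 𝕏 *A Cb))
      ≈⟨ trans (distribˡ W Cb′ _) (+-congˡ {W *A Cb′} (distribˡ W (𝕏 *A ρ Cb) (𝕏 *A Cb))) ⟩
    W *A Cb′ +A (W *A (𝕏 *A ρ Cb) +A W *A (𝕏 *A Cb))
      ≈⟨ +-congˡ {W *A Cb′} (+-cong (*-assoc W 𝕏 (ρ Cb)) (*-assoc W 𝕏 Cb)) ⟨
    W *A Cb′ +A common a b ∎
    where
    W = ρpow a ; Cb = C (suc b) ; Cb′ = C (suc (suc b))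

  ρpow*𝕏-∗ρ-expansion : ∀ a b → ρpow*𝕏 a ∗ρ C (suc b) ≈ ρpow (suc a) *A C (suc b) +A common a b
  ρpow*𝕏-∗ρ-expansion a b = +-assoc (ρpow (suc a) *A C (suc b)) (ρpow*𝕏 a *A ρ (C (suc b))) (ρpow*𝕏 a *A C (suc b))

  ρpow-shift : ∀ k → ρpow*𝕏 (suc k) +A ∑[ a + b ≡ k ] (ρpow a *A C (suc (suc b)))
                   ≈ C (suc (suc k)) +A ∑[ a + b ≡ k ] (ρpow (suc a) *A C (suc b))
  ρpow-shift k = begin
    ρpow*𝕏 (suc k) +A S                                             ≈⟨ +-comm (ρpow*𝕏 (suc k)) S ⟩
    S +A ρpow (suc k) *A C 1                                        ≈⟨ ∑ᵃᵈ-unfoldʳ k (λ a b → ρpow a *A C (suc b)) ⟨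
    ∑[ a + b ≡ suc k ] (ρpow a *A C (suc b))                        ≈⟨ +-congʳ (*-identityˡ (C (suc (suc k)))) ⟩
    C (suc (suc k)) +A ∑[ a + b ≡ k ] (ρpow (suc a) *A C (suc b))   ∎
    where
    S = ∑[ a + b ≡ k ] (ρpow a *A C (suc (suc b)))

  ρpow*𝕏-recurrence : ∀ k → ρpow*𝕏 (suc k) +A ∑[ a + b ≡ k ] (ρpow a *A ρ (C (suc b)) *A 𝕏) ≈ recurrence ρpow*𝕏 (suc k)
  ρpow*𝕏-recurrence k = begin
    ρpow*𝕏 (suc k) +A ∑[ a + b ≡ k ] (ρpow a *A ρ (C (suc b)) *A 𝕏)
      ≈⟨ +-congˡ {ρpow*𝕏 (suc k)} (trans (∑ᵃᵈ-cong k (λ a b _ → ρpow*ρcpow*𝕏-expansion a b)) (∑ᵃᵈ-distrib-∙ k _ common)) ⟩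
    ρpow*𝕏 (suc k) +A (S₁ +A ∑ᵃᵈ k common)
      ≈⟨ +-assoc (ρpow*𝕏 (suc k)) S₁ (∑ᵃᵈ k common) ⟨
    ρpow*𝕏 (suc k) +A S₁ +A ∑ᵃᵈ k common
      ≈⟨ +-congʳ (ρpow-shift k) ⟩
    C (suc (suc k)) +A S₂ +A ∑ᵃᵈ k common
      ≈⟨ +-assoc (C (suc (suc k))) S₂ (∑ᵃᵈ k common) ⟩
    C (suc (suc k)) +A (S₂ +A ∑ᵃᵈ k common)
      ≈⟨ +-congˡ {C (suc (suc k))} (trans (∑ᵃᵈ-cong k (λ a b _ → ρpow*𝕏-∗ρ-expansion a b)) (∑ᵃᵈ-distrib-∙ k _ common)) ⟨
    recurrence ρpow*𝕏 (suc k) ∎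
    where
    S₁ = ∑[ a + b ≡ k ] (ρpow a *A C (suc (suc b)))
    S₂ = ∑[ a + b ≡ k ] (ρpow (suc a) *A C (suc b))

  ρ-recurrence : ∀ k → ρ (recurrence ρpow*𝕏 (suc k)) ≈ ∑[ a + b ≡ suc k ] (ρpow a *A ρ (C (suc b)))
  ρ-recurrence k = begin
    ρ (C (suc (suc k)) +A S)
      ≈⟨ ρ-+ (C (suc (suc k))) S ⟩
    ρ (C (suc (suc k))) +A ρ S
      ≈⟨ +-cong (sym (*-identityˡ (ρ (C (suc (suc k)))))) (∑ᵃᵈ-homo ρ ρ-+ k _) ⟩
    1A *A ρ (C (suc (suc k))) +A ∑[ a + b ≡ k ] ρ (ρpow*𝕏 a ∗ρ C (suc b))
      ≈⟨ +-congˡ {1A *A ρ (C (suc (suc k)))} (∑ᵃᵈ-cong k (λ a b _ → ρ-∗ρ (ρpow*𝕏 a) (C (suc b)))) ⟨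
    ∑[ a + b ≡ suc k ] (ρpow a *A ρ (C (suc b))) ∎
    where
    S = ∑[ a + b ≡ k ] (ρpow*𝕏 a ∗ρ C (suc b))

  scaled-ρpow*𝕏-suc : ∀ k → fromℕ F (suc k) ·A ρpow (suc k) ≈ ∑[ a + b ≡ k ] (ρpow a *A ρ (C (suc b))) →
                      fromℕ F (suc (suc k)) ·A ρpow*𝕏 (suc k) ≈ recurrence ρpow*𝕏 (suc k)
  scaled-ρpow*𝕏-suc k IH = begin
    fromℕ F (suc (suc k)) ·A ρpow*𝕏 (suc k)
      ≈⟨ fromℕ-suc-· (suc k) (ρpow*𝕏 (suc k)) ⟩
    ρpow*𝕏 (suc k) +A fromℕ F (suc k) ·A ρpow*𝕏 (suc k)
      ≈⟨ +-congˡ {ρpow*𝕏 (suc k)} (·-*-assoc (fromℕ F (suc k)) (ρpow (suc k)) 𝕏) ⟨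
    ρpow*𝕏 (suc k) +A (fromℕ F (suc k) ·A ρpow (suc k)) *A 𝕏
      ≈⟨ +-congˡ {ρpow*𝕏 (suc k)} (trans (*-congʳ IH) (∑ᵃᵈ-homo (_*A 𝕏) (*-additive 𝕏) k _)) ⟩
    ρpow*𝕏 (suc k) +A ∑[ a + b ≡ k ] (ρpow a *A ρ (C (suc b)) *A 𝕏)
      ≈⟨ ρpow*𝕏-recurrence k ⟩
    recurrence ρpow*𝕏 (suc k) ∎

  scaled-ρpow : ∀ k → fromℕ F (suc k) ·A ρpow (suc k) ≈ ∑[ a + b ≡ k ] (ρpow a *A ρ (C (suc b)))
  scaled-ρpow zero = begin
    fromℕ F 1 ·A ρ (1A *A 𝕏)   ≈⟨ ·-cong (K.+-identityʳ K.1#) (ρ-cong (*-identityˡ 𝕏)) ⟩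
    K.1# ·A ρ 𝕏                ≈⟨ ·-identityˡ (ρ 𝕏) ⟩
    ρ 𝕏                        ≈⟨ *-identityˡ (ρ 𝕏) ⟨
    1A *A ρ (C 1)              ∎
  scaled-ρpow (suc k) = begin
    fromℕ F (suc (suc k)) ·A ρ (ρpow*𝕏 (suc k))   ≈⟨ ρ-· (fromℕ F (suc (suc k))) (ρpow*𝕏 (suc k)) ⟨
    ρ (fromℕ F (suc (suc k)) ·A ρpow*𝕏 (suc k))   ≈⟨ ρ-cong (scaled-ρpow*𝕏-suc k (scaled-ρpow k)) ⟩
    ρ (recurrence ρpow*𝕏 (suc k))                 ≈⟨ ρ-recurrence k ⟩
    ∑[ a + b ≡ suc k ] (ρpow a *A ρ (C (suc b)))  ∎

  scaled-ρpow*𝕏 : ∀ k → fromℕ F (suc k) ·A ρpow*𝕏 k ≈ recurrence ρpow*𝕏 k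
  scaled-ρpow*𝕏 zero    = trans (·-cong (K.+-identityʳ K.1#) (*-identityˡ 𝕏)) (·-identityˡ 𝕏)
  scaled-ρpow*𝕏 (suc k) = scaled-ρpow*𝕏-suc k (scaled-ρpow k)

  ρpow*𝕏-solves : SolvesRecurrence ρpow*𝕏
  ρpow*𝕏-solves m = ·-cancel m (scaled-ρpow*𝕏 m)

  rhsTerm : List ℕ → 𝒜
  rhsTerm is = invℕ (denom is) ·A starProd is

  starProd-snoc : ∀ i is j → starProd (i ∷ is ++ [ j ]) ≡ starProd (i ∷ is) ∗ρ C j
  starProd-snoc i is j = foldl-++ (λ acc j → acc ∗ρ C j) (C i) is [ j ]

  rhsTerm-snoc : ∀ {n} is j → sum is ≡ suc n → rhsTerm (is ++ [ j ]) ≈ invℕ (suc n +ℕ j) ·A (rhsTerm is ∗ρ C j)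
  rhsTerm-snoc {n} (i ∷ is) j sum≡ = begin
    invℕ (denom (i ∷ is ++ [ j ])) ·A starProd (i ∷ is ++ [ j ])
      ≡⟨ ≡.cong₂ (λ d s → invℕ d ·A s) denom≡ (starProd-snoc i is j) ⟩
    invℕ (denom (i ∷ is) *ℕ (suc n +ℕ j)) ·A (starProd (i ∷ is) ∗ρ C j)
      ≈⟨ ·-cong (K.trans (invℕ-* (denom (i ∷ is)) (suc n +ℕ j)) (K.*-comm _ _)) refl ⟩
    (invℕ (suc n +ℕ j) K.* invℕ (denom (i ∷ is))) ·A (starProd (i ∷ is) ∗ρ C j)
      ≈⟨ ·-assoc _ _ _ ⟩
    invℕ (suc n +ℕ j) ·A invℕ (denom (i ∷ is)) ·A (starProd (i ∷ is) ∗ρ C j)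
      ≈⟨ ·-cong K.refl (·-∗ρ-assoc _ _ _) ⟨
    invℕ (suc n +ℕ j) ·A (rhsTerm (i ∷ is) ∗ρ C j) ∎
    where
    denom≡ : denom (i ∷ is ++ [ j ]) ≡ denom (i ∷ is) *ℕ (suc n +ℕ j)
    denom≡ = ≡.trans (denom-snoc (i ∷ is) j) (≡.cong (λ s → denom (i ∷ is) *ℕ (s +ℕ j)) sum≡)

  RHS-solves : SolvesRecurrence (RHS ∘ suc)
  RHS-solves zero    = +-identityʳ (invℕ 1 ·A 𝕏)
  RHS-solves (suc k) = begin
    RHS n
      ≈⟨ ∑-compositions-last +-commutativeMonoid (suc k) rhsTerm ⟩
    ∑[ a + b ≡ suc k ] ∑[ js ∈ compositions a ] rhsTerm (js ++ [ suc b ])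
      ≈⟨ +-cong single-part (∑ᵃᵈ-cong k several-parts) ⟩
    invℕ n ·A C n +A ∑[ a + b ≡ k ] (invℕ n ·A (RHS (suc a) ∗ρ C (suc b)))
      ≈⟨ trans (·-distribˡ (invℕ n) (C n) _) (+-congˡ {invℕ n ·A C n} (∑ᵃᵈ-homo (invℕ n ·A_) (·-distribˡ (invℕ n)) k _)) ⟨
    invℕ n ·A recurrence (RHS ∘ suc) (suc k) ∎
    where
    n = suc (suc k)
    single-part : rhsTerm [ n ] +A 0A ≈ invℕ n ·A C n
    single-part = trans (+-identityʳ (rhsTerm [ n ])) (·-cong (K.reflexive (≡.cong invℕ (ℕ.*-identityʳ n))) refl)
    several-parts : ∀ a b → a +ℕ b ≡ k →
      ∑[ js ∈ compositions (suc a) ] rhsTerm (js ++ [ suc b ]) ≈ invℕ n ·A (RHS (suc a) ∗ρ C (suc b))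
    several-parts a b a+b≡k = begin
      ∑[ js ∈ compositions (suc a) ] rhsTerm (js ++ [ suc b ])
        ≈⟨ ∑-cong-All (compositions-sum (suc a)) (λ {js} sum≡ → rhsTerm-snoc js (suc b) sum≡) ⟩
      ∑[ js ∈ compositions (suc a) ] (invℕ (suc a +ℕ suc b) ·A (rhsTerm js ∗ρ C (suc b)))
        ≡⟨ ≡.cong (λ m → ∑[ js ∈ compositions (suc a) ] (invℕ m ·A (rhsTerm js ∗ρ C (suc b)))) a+b+2≡n ⟩
      ∑[ js ∈ compositions (suc a) ] (invℕ n ·A (rhsTerm js ∗ρ C (suc b)))
        ≈⟨ ∑-additive (invℕ n ·A_) (·-distribˡ (invℕ n)) (compositions (suc a)) _ ⟨
      invℕ n ·A ∑[ js ∈ compositions (suc a) ] (rhsTerm js ∗ρ C (suc b))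
        ≈⟨ ·-cong K.refl (∑-additive (_∗ρ C (suc b)) (∗ρ-additive (C (suc b))) (compositions (suc a)) rhsTerm) ⟨
      invℕ n ·A (RHS (suc a) ∗ρ C (suc b)) ∎
      where
      a+b+2≡n : suc a +ℕ suc b ≡ n
      a+b+2≡n = ≡.cong suc (≡.trans (ℕ.+-suc a b) (≡.cong suc a+b≡k))

mainTheorem10 : ∀ {c ℓ : Level} (F : Field c ℓ) (χ : CharZero F) (n : ℕ) → 1 ≤ n →
    let open Alg F χ in (ρpow (n ∸ 1) *A 𝕏) ≈A RHS n
mainTheorem10 F χ (suc m) (s≤s z≤n) i = coeff-≈ (recurrence-unique ρpow*𝕏-solves RHS-solves m i)
  where
  open FreeAlgebra F χ using (coeff-≈)
  open Expansion F χ using (recurrence-unique; ρpow*𝕏-solves; RHS-solves)
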